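{- If $n\ge m\ge 1$, then $$\mathrm{mob}(K_n\,\square\, K_m)=\begin{cases} n, & m\in\{1,2\},\\ n+m-3, & m\ge 3.\end{cases}$$
   Context: $\square$ denotes the Cartesian product: vertex set $V(G)\times V(H)$, $(g,h)\sim(g',h')$ iff ($gg'\in E(G)$, $h=h'$) or ($g=g'$, $hh'\in E(H)$). A set $S\subseteq V(G)$ is a general position set if no three vertices of $S$ lie on a common shortest path. Robots are placed one per vertex of a general position set $S$; a move $u\to v$ along an edge $uv$ with $u\in S$ is legal if $v\notin S$ and $(S\setminus\{u\})\cup\{v\}$ is a general position set. $S$ is a mobile general position set if some sequence of legal moves starting from $S$ visits every vertex at least once; $\mathrm{mob}(G)$ is the maximum size of a mobile general position set. -}

module Defs where

open import Level using (0ℓ)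
open import Data.Nat using (ℕ; zero; suc; _≤_)
open import Data.Fin using (Fin)
open import Data.Product using (Σ; ∃; _×_; _,_)
open import Data.Sum using (_⊎_)
open import Data.List using (List; []; _∷_; length)
open import Data.List.Membership.Propositional using (_∈_; _∉_)
open import Data.List.Relation.Unary.Any using (Any)
open import Data.List.Relation.Unary.Unique.Propositional using (Unique)
open import Relation.Binary.PropositionalEquality using (_≡_; _≢_)
open import Relation.Nullary using (¬_)
open import Function.Bundles using (_⇔_)

record Graph : Set₁ where
  field
    V   : Set
    Adj : V → V → Set

open Graph public

K : ℕ → Graph
K n = record { V = Fin n ; Adj = λ i j → i ≢ j }

_□_ : Graph → Graph → Graph
G □ H = record
  { V   = V G × V H
  ; Adj = λ { (g , h) (g′ , h′) → (Adj G g g′ × h ≡ h′) ⊎ (g ≡ g′ × Adj H h h′) } }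

module _ (G : Graph) where

  data Walk : V G → V G → Set where
    here : ∀ {x} → Walk x x
    step : ∀ {x z y} → Adj G x z → Walk z y → Walk x y

  walkLength : ∀ {x y} → Walk x y → ℕ
  walkLength here       = zero
  walkLength (step _ w) = suc (walkLength w)

  data OnWalk (v : V G) : ∀ {x y} → Walk x y → Set where
    onHere : ∀ {y} {w : Walk v y} → OnWalk v w
    onStep : ∀ {x z y} {e : Adj G x z} {w : Walk z y} → OnWalk v w → OnWalk v (step e w)

  Geodesic : ∀ {x y} → Walk x y → Set
  Geodesic {x} {y} w = ∀ (w′ : Walk x y) → walkLength w ≤ walkLength w′

  OnCommonGeodesic : V G → V G → V G → Set
  OnCommonGeodesic a b c =
    Σ (V G) λ x → Σ (V G) λ y → Σ (Walk x y) λ w →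
      Geodesic w × OnWalk a w × OnWalk b w × OnWalk c w

  -- General position set (vertex sets are duplicate-free lists).
  GenPos : List (V G) → Set
  GenPos S = Unique S ×
    (∀ {a b c} → a ∈ S → b ∈ S → c ∈ S → a ≢ b → a ≢ c → b ≢ c →
       ¬ OnCommonGeodesic a b c)

  LegalMove : List (V G) → List (V G) → Set
  LegalMove S S′ = Σ (V G) λ u → Σ (V G) λ v →
    u ∈ S × v ∉ S × Adj G u v × GenPos S′ ×
    (∀ x → (x ∈ S′) ⇔ ((x ∈ S × x ≢ u) ⊎ x ≡ v))

  data MoveSeq : List (V G) → List (List (V G)) → Set where
    done : ∀ {S} → MoveSeq S []
    move : ∀ {S S′ Ss} → LegalMove S S′ → MoveSeq S′ Ss → MoveSeq S (S′ ∷ Ss)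

  Mobile : List (V G) → Set
  Mobile S = GenPos S × Σ (List (List (V G))) λ Ss →
    MoveSeq S Ss × (∀ x → Any (x ∈_) (S ∷ Ss))

  IsMob : ℕ → Set
  IsMob k = (Σ (List (V G)) λ S → Mobile S × length S ≡ k) ×
            (∀ S → Mobile S → length S ≤ k)

module Submission where

-- In K n □ K m any two cells are at distance at most 2, so a duplicate-free S is in general position
-- iff it has no corner: no robot with both a row-mate and a column-mate. Charging each robot of such
-- an S to its column if it has a row-mate and to its row otherwise is injective, so |S| + u ≤ n + m
-- when u lines are uncharged. For m = 1 a column is uncharged and for m = 2 two lines are. For m ≥ 3,
-- a case analysis of a move along a column (a move along a row is one along a column of the transposed
-- board) gives three uncharged lines once S admits a legal move, and a mobile S without moves would
-- have to occupy every cell.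
-- Conversely, place a robot in column 0 of every row but row 0, and robots in the columns 2, …, m − 1
-- of row 0. For each x ≥ 2 the other rows can move one at a time through the columns 0 → 1 → x → 0
-- while single robots of row 0 step aside, and these rounds together visit every cell. For m = 2 a
-- single such pass with one robot in row 0 works, and for m = 1 a full column occupies every cell.

open import Defs
open import Data.Empty using (⊥; ⊥-elim)
open import Data.Fin using (Fin; zero; suc; toℕ; fromℕ<)
open import Data.Fin.Properties using (_≟_)
import Data.Fin.Properties as Fin
open import Data.List using (List; []; _∷_; length; map; _++_; allFin; filter)
open import Data.List.Membership.Propositional using (_∈_; _∉_; find; lose)
open import Data.List.Membership.Propositional.Properties
  using (∈-map⁺; ∈-map⁻; ∈-++⁺ˡ; ∈-++⁺ʳ; ∈-++⁻; ∈-allFin; ∈-filter⁺; ∈-filter⁻)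
import Data.List.Membership.DecPropositional as DecMembership
open import Data.List.Properties using (length-removeAt′; length-map; length-++; length-tabulate; map-cong)
open import Data.List.Relation.Binary.Subset.Propositional using (_⊆_)
open import Data.List.Relation.Unary.All using (All; []; _∷_)
import Data.List.Relation.Unary.All as All
import Data.List.Relation.Unary.All.Properties as All
open import Data.List.Relation.Unary.AllPairs using ([]; _∷_)
open import Data.List.Relation.Unary.Any using (Any; here; there; index; _─_; any?)
import Data.List.Relation.Unary.Any.Properties as Any
open import Data.List.Relation.Unary.Unique.Propositional using (Unique)
import Data.List.Relation.Unary.Unique.Propositional.Properties as Unique
open import Data.Nat using (ℕ; zero; suc; _≤_; _<_; _+_; _∸_; z≤n; s≤s; _<?_)
open import Data.Nat.Properties
  using (module ≤-Reasoning; ≤-refl; ≤-reflexive; ≤-trans; <⇒≤; ≤⇒≯; n<1+n; m<n⇒m<1+n; <-cmp;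
         +-comm; +-cancelʳ-≤; m+n≤o⇒m≤o∸n)
open import Data.Nat.Tactic.RingSolver using (solve-∀)
open import Data.Product using (Σ; ∃; _×_; _,_; proj₁; proj₂; swap)
import Data.Product as Product
open import Data.Product.Properties using (≡-dec)
open import Data.Sum using (_⊎_; inj₁; inj₂)
import Data.Sum.Properties as Sum
open import Function using (_∘_; id; const)
open import Function.Bundles using (Equivalence; _⇔_; mk⇔)
open import Relation.Binary.Definitions using (DecidableEquality; tri<; tri≈; tri>)
open import Relation.Binary.PropositionalEquality
  using (_≡_; _≢_; refl; sym; trans; cong; cong₂; subst; module ≡-Reasoning)
open import Relation.Nullary using (¬_; Dec; yes; no; contradiction; ¬?)
open import Relation.Nullary.Decidable using (map′; _×-dec_; decidable-stable)
open import Relation.Unary using (_∪_) renaming (_⊆_ to _⊆′_)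

module _ {A : Set} where

  ∈-─⁺ : ∀ {x y : A} {ys} (x∈ys : x ∈ ys) → y ∈ ys → y ≢ x → y ∈ (ys ─ x∈ys)
  ∈-─⁺ (here refl)  (here refl)  y≢x = ⊥-elim (y≢x refl)
  ∈-─⁺ (here refl)  (there y∈ys) _   = y∈ys
  ∈-─⁺ (there _)    (here refl)  _   = here refl
  ∈-─⁺ (there x∈ys) (there y∈ys) y≢x = there (∈-─⁺ x∈ys y∈ys y≢x)

  unique-⊆⇒length-≤ : ∀ {xs ys : List A} → Unique xs → xs ⊆ ys → length xs ≤ length ys
  unique-⊆-∉⇒length-< : ∀ {xs ys : List A} {y} → Unique xs → xs ⊆ ys → y ∈ ys → y ∉ xs →
                        length xs < length ys

  unique-⊆⇒length-≤ {[]}     _             _     = z≤n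
  unique-⊆⇒length-≤ {x ∷ xs} (x≢xs ∷ uxs) xs⊆ys =
    unique-⊆-∉⇒length-< uxs (xs⊆ys ∘ there) (xs⊆ys (here refl)) (λ x∈xs → All.lookup x≢xs x∈xs refl)

  unique-⊆-∉⇒length-< {xs} {ys} uxs xs⊆ys y∈ys y∉xs = begin-strict
    length xs                ≤⟨ unique-⊆⇒length-≤ uxs xs⊆ys─y ⟩
    length (ys ─ y∈ys)       <⟨ n<1+n _ ⟩
    suc (length (ys ─ y∈ys)) ≡⟨ sym (length-removeAt′ ys (index y∈ys)) ⟩
    length ys                ∎
    where
      open ≤-Reasoning
      xs⊆ys─y : xs ⊆ (ys ─ y∈ys)
      xs⊆ys─y x∈xs = ∈-─⁺ y∈ys (xs⊆ys x∈xs) (λ { refl → y∉xs x∈xs })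

  map-injectiveOn-unique : ∀ {B : Set} (f : A → B) {xs} →
                           (∀ {x y} → x ∈ xs → y ∈ xs → f x ≡ f y → x ≡ y) → Unique xs → Unique (map f xs)
  map-injectiveOn-unique f {[]}     _   []            = []
  map-injectiveOn-unique f {x ∷ xs} inj (x≢xs ∷ uxs) =
    All.map⁺ (All.tabulate λ y∈xs → All.lookup x≢xs y∈xs ∘ inj (here refl) (there y∈xs)) ∷
    map-injectiveOn-unique f (λ p q → inj (there p) (there q)) uxs

  length-map-allFin : ∀ {k} (f : Fin k → A) → length (map f (allFin k)) ≡ k
  length-map-allFin {k} f = trans (length-map f (allFin k)) (length-tabulate {n = k} id)

  unique-⊆-length-≥⇒⊇ : DecidableEquality A → ∀ {xs ys : List A} →
                        Unique xs → xs ⊆ ys → length ys ≤ length xs → ys ⊆ xs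
  unique-⊆-length-≥⇒⊇ _≟_ {xs} uxs xs⊆ys ys≤xs {y} y∈ys with DecMembership._∈?_ _≟_ y xs
  ... | yes y∈xs = y∈xs
  ... | no  y∉xs = contradiction (unique-⊆-∉⇒length-< uxs xs⊆ys y∈ys y∉xs) (≤⇒≯ ys≤xs)

-- General position in graphs of diameter two

module _ (G : Graph) where

  vertices : ∀ {x y} → Walk G x y → List (V G)
  vertices {x} here       = x ∷ []
  vertices {x} (step _ w) = x ∷ vertices w

  onWalk⇒∈vertices : ∀ {v x y} {w : Walk G x y} → OnWalk G v w → v ∈ vertices w
  onWalk⇒∈vertices {w = here}     onHere     = here refl
  onWalk⇒∈vertices {w = step _ _} onHere     = here refl
  onWalk⇒∈vertices                (onStep o) = there (onWalk⇒∈vertices o)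

  record InducedP₃ (S : List (V G)) : Set where
    field
      {x z y} : V G
      x∈S     : x ∈ S
      z∈S     : z ∈ S
      y∈S     : y ∈ S
      x~z     : Adj G x z
      z~y     : Adj G z y
      x≢y     : x ≢ y
      x≁y     : ¬ Adj G x y

  InducedP₃⇒¬GenPos : ∀ {S} → InducedP₃ S → ¬ GenPos G S
  InducedP₃⇒¬GenPos p₃ (_ , gp) =
    gp x∈S z∈S y∈S (λ { refl → x≁y z~y }) x≢y (λ { refl → x≁y x~z }) on-geodesic
    where
      open InducedP₃ p₃
      path : Walk G x y
      path = step x~z (step z~y here)
      geodesic : Geodesic G path
      geodesic here                = ⊥-elim (x≢y refl)
      geodesic (step x~y here)     = ⊥-elim (x≁y x~y)
      geodesic (step _ (step _ _)) = s≤s (s≤s z≤n)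
      on-geodesic : OnCommonGeodesic G _ _ _
      on-geodesic = _ , _ , path , geodesic , onHere , onStep onHere , onStep (onStep onHere)

  Diameter≤2 : Set
  Diameter≤2 = ∀ x y → Σ (Walk G x y) λ w → walkLength G w ≤ 2

  module _ (_≟_ : DecidableEquality (V G)) (diam : Diameter≤2) where

    -- Three distinct vertices on a geodesic of length at most 2 are all of its vertices.
    onCommonGeodesic⇒InducedP₃ : ∀ {S a b c} → a ∈ S → b ∈ S → c ∈ S → a ≢ b → a ≢ c → b ≢ c →
                                 OnCommonGeodesic G a b c → InducedP₃ S
    onCommonGeodesic⇒InducedP₃ {S} {a} {b} {c} a∈S b∈S c∈S a≢b a≢c b≢c
                               (_ , _ , w , geo , a∈w , b∈w , c∈w) =
      along w geo (All.lookup (onWalk⇒∈vertices a∈w ∷ onWalk⇒∈vertices b∈w ∷ onWalk⇒∈vertices c∈w ∷ []))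
      where
        abc : List (V G)
        abc = a ∷ b ∷ c ∷ []
        abc-unique : Unique abc
        abc-unique = (a≢b ∷ a≢c ∷ []) ∷ (b≢c ∷ []) ∷ [] ∷ []
        abc⊆S : abc ⊆ S
        abc⊆S = All.lookup (a∈S ∷ b∈S ∷ c∈S ∷ [])
        along : ∀ {x y} (w : Walk G x y) → Geodesic G w → abc ⊆ vertices w → InducedP₃ S
        along here          _ abc⊆w = contradiction (unique-⊆⇒length-≤ abc-unique abc⊆w) λ { (s≤s ()) }
        along (step _ here) _ abc⊆w = contradiction (unique-⊆⇒length-≤ abc-unique abc⊆w) λ { (s≤s (s≤s ())) }
        along (step x~z (step z~y here)) geo abc⊆w = record
          { x∈S = abc⊆S (w⊆abc (here refl))
          ; z∈S = abc⊆S (w⊆abc (there (here refl)))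
          ; y∈S = abc⊆S (w⊆abc (there (there (here refl))))
          ; x~z = x~z
          ; z~y = z~y
          ; x≢y = λ { refl → contradiction (geo here) λ () }
          ; x≁y = λ x~y → contradiction (geo (step x~y here)) λ { (s≤s ()) }
          }
          where
            w⊆abc : vertices (step x~z (step z~y here)) ⊆ abc
            w⊆abc = unique-⊆-length-≥⇒⊇ _≟_ abc-unique abc⊆w ≤-refl
        along {x} {y} (step _ (step _ (step _ _))) geo _ =
          contradiction (≤-trans (geo (proj₁ (diam x y))) (proj₂ (diam x y))) λ { (s≤s (s≤s ())) }

    noInducedP₃⇒GenPos : ∀ {S} → Unique S → ¬ InducedP₃ S → GenPos G S
    noInducedP₃⇒GenPos uS noP₃ = uS , λ a∈S b∈S c∈S a≢b a≢c b≢c →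
      noP₃ ∘ onCommonGeodesic⇒InducedP₃ a∈S b∈S c∈S a≢b a≢c b≢c

module _ (G : Graph) where

  Replacement : List (V G) → List (V G) → V G → V G → Set
  Replacement S S′ u v = ∀ x → (x ∈ S′) ⇔ ((x ∈ S × x ≢ u) ⊎ x ≡ v)

  module _ {S S′ : List (V G)} {u v : V G} where

    replacement-keeps : Replacement S S′ u v → ∀ {x} → x ∈ S → x ≢ u → x ∈ S′
    replacement-keeps S′≈ x∈S x≢u = Equivalence.from (S′≈ _) (inj₁ (x∈S , x≢u))

    replacement-adds : Replacement S S′ u v → v ∈ S′
    replacement-adds S′≈ = Equivalence.from (S′≈ v) (inj₂ refl)

    replacement : DecidableEquality (V G) → u ∉ S′ → v ∈ S′ →
                  (∀ {x} → x ∈ S → x ≢ u → x ∈ S′) → (∀ {x} → x ∈ S′ → x ≢ v → x ∈ S) →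
                  Replacement S S′ u v
    replacement _≟_ u∉S′ v∈S′ keeps came-from x = mk⇔ to from
      where
        to : x ∈ S′ → (x ∈ S × x ≢ u) ⊎ x ≡ v
        to x∈S′ with x ≟ v
        ... | yes x≡v = inj₂ x≡v
        ... | no  x≢v = inj₁ (came-from x∈S′ x≢v , λ { refl → u∉S′ x∈S′ })
        from : (x ∈ S × x ≢ u) ⊎ x ≡ v → x ∈ S′
        from (inj₁ (x∈S , x≢u)) = keeps x∈S x≢u
        from (inj₂ refl)        = v∈S′

  data Run : List (V G) → List (V G) → List (List (V G)) → Set where
    []  : ∀ {S} → Run S S []
    _∷_ : ∀ {S S′ T Ss} → LegalMove G S S′ → Run S′ T Ss → Run S T (S′ ∷ Ss)

  Visits : List (V G) → List (List (V G)) → V G → Set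
  Visits S Ss x = Any (x ∈_) (S ∷ Ss)

  record Trip (S T : List (V G)) (P : V G → Set) : Set where
    field
      {configs} : List (List (V G))
      run       : Run S T configs
      visits    : ∀ {x} → P x → Visits S configs x

  Leg : List (V G) → List (V G) → Set
  Leg S T = Trip S T (_∈ T)

module _ {G : Graph} where

  run⇒moveSeq : ∀ {S T Ss} → Run G S T Ss → MoveSeq G S Ss
  run⇒moveSeq []         = done
  run⇒moveSeq (mv ∷ run) = move mv (run⇒moveSeq run)

  _▷_ : ∀ {S T U Ss Ts} → Run G S T Ss → Run G T U Ts → Run G S U (Ss ++ Ts)
  []         ▷ run′ = run′
  (mv ∷ run) ▷ run′ = mv ∷ (run ▷ run′)

  visits-end : ∀ {S T Ss x} → Run G S T Ss → x ∈ T → Visits G S Ss x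
  visits-end []        x∈T = here x∈T
  visits-end (_ ∷ run) x∈T = there (visits-end run x∈T)

  visits-++ʳ : ∀ {S Ss x} Ts → Visits G S Ss x → Visits G S (Ss ++ Ts) x
  visits-++ʳ _ (here x∈S)   = here x∈S
  visits-++ʳ _ (there x∈Ss) = there (Any.++⁺ˡ x∈Ss)

  visits-▷ : ∀ {S T Ss Ts x} → Run G S T Ss → Visits G T Ts x → Visits G S (Ss ++ Ts) x
  visits-▷ []        v = v
  visits-▷ (_ ∷ run) v = there (visits-▷ run v)

  stay : ∀ {S} → Leg G S S
  stay = record { run = [] ; visits = here }

  run⇒trip : ∀ {S T Ss} → Run G S T Ss → Leg G S T
  run⇒trip run = record { run = run ; visits = visits-end run }

  move⇒trip : ∀ {S S′} → LegalMove G S S′ → Leg G S S′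
  move⇒trip mv = run⇒trip (mv ∷ [])

  infixr 5 _⨾_
  _⨾_ : ∀ {S T U P Q} → Trip G S T P → Trip G T U Q → Trip G S U (P ∪ Q)
  trip₁ ⨾ trip₂ = record
    { run    = Trip.run trip₁ ▷ Trip.run trip₂
    ; visits = λ { (inj₁ p) → visits-++ʳ _ (Trip.visits trip₁ p)
                 ; (inj₂ q) → visits-▷ (Trip.run trip₁) (Trip.visits trip₂ q) }
    }

  trip-weaken : ∀ {S T P Q} → Q ⊆′ P → Trip G S T P → Trip G S T Q
  trip-weaken Q⊆P trip = record { run = Trip.run trip ; visits = Trip.visits trip ∘ Q⊆P }

  concat-loops : ∀ {A : Set} {S} {P : A → V G → Set} (ts : List A) → (∀ t → Trip G S S (P t)) →
                 Trip G S S (λ x → Any (λ t → P t x) ts)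
  concat-loops []       _    = record { run = [] ; visits = λ () }
  concat-loops (t ∷ ts) loop =
    trip-weaken (λ { (here p) → inj₁ p ; (there p) → inj₂ p }) (loop t ⨾ concat-loops ts loop)

  trip⇒mobile : ∀ {S T P} → GenPos G S → Trip G S T P → (∀ x → P x) → Mobile G S
  trip⇒mobile gp trip everywhere = gp , _ , run⇒moveSeq (Trip.run trip) , Trip.visits trip ∘ everywhere

-- Corners and charges in K n □ K m

module Rook (n m : ℕ) where

  Board : Graph
  Board = K n □ K m

  Cell : Set
  Cell = Fin n × Fin m

  CornerFree : List Cell → Set
  CornerFree S = ∀ {i i′ j j′} → (i , j) ∈ S → (i , j′) ∈ S → (i′ , j) ∈ S → j′ ≢ j → i′ ≢ i → ⊥

  diameter≤2 : Diameter≤2 Board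
  diameter≤2 (i , j) (i′ , j′) with i ≟ i′ | j ≟ j′
  ... | yes refl | yes refl = here , z≤n
  ... | yes refl | no j≢j′  = step (inj₂ (refl , j≢j′)) here , s≤s z≤n
  ... | no i≢i′  | yes refl = step (inj₁ (i≢i′ , refl)) here , s≤s z≤n
  ... | no i≢i′  | no j≢j′  =
    step (inj₁ (i≢i′ , refl)) (step (inj₂ (refl , j≢j′)) here) , s≤s (s≤s z≤n)

  InducedP₃⇒¬CornerFree : ∀ {S} → InducedP₃ Board S → ¬ CornerFree S
  InducedP₃⇒¬CornerFree
    record { x∈S = x∈S ; z∈S = z∈S ; y∈S = y∈S ; x~z = x~z ; z~y = z~y ; x≢y = x≢y ; x≁y = x≁y } cf
    with x~z | z~y
  ... | inj₁ (_ , refl)    | inj₁ (_ , refl)    = x≁y (inj₁ ((λ { refl → x≢y refl }) , refl))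
  ... | inj₁ (i≢i′ , refl) | inj₂ (refl , j≢j′) = cf z∈S y∈S x∈S (j≢j′ ∘ sym) i≢i′
  ... | inj₂ (refl , j≢j′) | inj₁ (i≢i′ , refl) = cf z∈S x∈S y∈S j≢j′ (i≢i′ ∘ sym)
  ... | inj₂ (refl , _)    | inj₂ (refl , _)    = x≁y (inj₂ (refl , (λ { refl → x≢y refl })))

  GenPos⇒CornerFree : ∀ {S} → GenPos Board S → CornerFree S
  GenPos⇒CornerFree gp ij∈S ij′∈S i′j∈S j′≢j i′≢i = InducedP₃⇒¬GenPos Board p₃ gp
    where
      p₃ : InducedP₃ Board _
      p₃ = record
        { x∈S = ij′∈S ; z∈S = ij∈S ; y∈S = i′j∈S
        ; x~z = inj₂ (refl , j′≢j)
        ; z~y = inj₁ (i′≢i ∘ sym , refl)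
        ; x≢y = λ ij′≡i′j → i′≢i (sym (cong proj₁ ij′≡i′j))
        ; x≁y = λ { (inj₁ (_ , j′≡j)) → j′≢j j′≡j ; (inj₂ (i≡i′ , _)) → i′≢i (sym i≡i′) }
        }

  CornerFree⇒GenPos : ∀ {S} → Unique S → CornerFree S → GenPos Board S
  CornerFree⇒GenPos uS cf =
    noInducedP₃⇒GenPos Board (≡-dec _≟_ _≟_) diameter≤2 uS (λ p₃ → InducedP₃⇒¬CornerFree p₃ cf)

  RowMate : List Cell → Cell → Set
  RowMate S (i , j) = ∃ λ j′ → (i , j′) ∈ S × j′ ≢ j

  rowMate? : ∀ S c → Dec (RowMate S c)
  rowMate? S (i , j) = map′ found (λ (j′ , ij′∈S , j′≢j) → lose ij′∈S (refl , j′≢j))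
                            (any? (λ (i′ , j′) → (i′ ≟ i) ×-dec ¬? (j′ ≟ j)) S)
    where
      found : Any (λ (i′ , j′) → i′ ≡ i × j′ ≢ j) S → RowMate S (i , j)
      found p with find p
      ... | (_ , j′) , ij′∈S , refl , j′≢j = j′ , ij′∈S , j′≢j

  rowMate-transfer : ∀ {S i j} → (i , j) ∈ S → RowMate S (i , j) → ∀ j′ → RowMate S (i , j′)
  rowMate-transfer {j = j} ij∈S mate j′ with j ≟ j′
  ... | yes refl = mate
  ... | no j≢j′  = j , ij∈S , j≢j′

  Line : Set
  Line = Fin n ⊎ Fin m

  pattern row i = inj₁ i
  pattern col j = inj₂ j

  charge : List Cell → Cell → Line
  charge S (i , j) with rowMate? S (i , j)
  ... | yes _ = col j
  ... | no  _ = row i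

  charged-to-row : ∀ S {i j i′} → charge S (i , j) ≡ row i′ → i ≡ i′ × ¬ RowMate S (i , j)
  charged-to-row S {i} {j} eq with rowMate? S (i , j)
  charged-to-row S refl | no ¬mate = refl , ¬mate

  charged-to-col : ∀ S {i j j′} → charge S (i , j) ≡ col j′ → j ≡ j′ × RowMate S (i , j)
  charged-to-col S {i} {j} eq with rowMate? S (i , j)
  charged-to-col S refl | yes mate = refl , mate

  charge-injective : ∀ {S} → CornerFree S →
                     ∀ {c c′} → c ∈ S → c′ ∈ S → charge S c ≡ charge S c′ → c ≡ c′
  charge-injective {S} cf {i , j} {i′ , j′} c∈S c′∈S eq with charge S (i , j) in e
  ... | row r with charged-to-row S e | charged-to-row S (sym eq)
  ...   | refl , ¬mate | refl , _ =
          cong (i ,_) (decidable-stable (j ≟ j′) λ j≢j′ → ¬mate (j′ , c′∈S , j≢j′ ∘ sym))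
  charge-injective {S} cf {i , j} {i′ , j′} c∈S c′∈S eq | col d
    with charged-to-col S e | charged-to-col S (sym eq)
  ...   | refl , (j″ , ij″∈S , j″≢j) | refl , _ =
          cong (_, j) (decidable-stable (i ≟ i′) λ i≢i′ → cf c∈S ij″∈S c′∈S j″≢j (i≢i′ ∘ sym))

  Uncharged : List Cell → Line → Set
  Uncharged S ℓ = ∀ {c} → c ∈ S → charge S c ≢ ℓ

  uncharged-or-charged : ∀ S ℓ → Uncharged S ℓ ⊎ ∃ λ c → c ∈ S × charge S c ≡ ℓ
  uncharged-or-charged S ℓ with DecMembership._∈?_ (Sum.≡-dec _≟_ _≟_) ℓ (map (charge S) S)
  ... | yes ℓ∈charges = inj₂ (Product.map₂ (Product.map₂ sym) (∈-map⁻ (charge S) ℓ∈charges))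
  ... | no  ℓ∉charges = inj₁ λ c∈S eq → ℓ∉charges (subst (_∈ _) eq (∈-map⁺ (charge S) c∈S))

  row-uncharged : ∀ {S i} → (∀ {j} → (i , j) ∈ S → RowMate S (i , j)) → Uncharged S (row i)
  row-uncharged {S} all-mated {_ , j} c∈S eq with charged-to-row S eq
  ... | refl , ¬mate = ¬mate (all-mated c∈S)

  mated-row-uncharged : ∀ {S i j} → (i , j) ∈ S → RowMate S (i , j) → Uncharged S (row i)
  mated-row-uncharged ij∈S mate = row-uncharged λ {j′} _ → rowMate-transfer ij∈S mate j′

  empty-row-uncharged : ∀ {S i} → (∀ {j} → (i , j) ∉ S) → Uncharged S (row i)
  empty-row-uncharged empty = row-uncharged (⊥-elim ∘ empty)

  unmated-col-uncharged : ∀ {S k d} → CornerFree S → (k , d) ∈ S → ¬ RowMate S (k , d) →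
                          Uncharged S (col d)
  unmated-col-uncharged {S} {k} cf kd∈S ¬mate {i , _} c∈S eq with charged-to-col S eq
  ... | refl , (j′ , ij′∈S , j′≢d) with i ≟ k
  ...   | yes refl = ¬mate (j′ , ij′∈S , j′≢d)
  ...   | no  i≢k  = cf c∈S ij′∈S kd∈S j′≢d (i≢k ∘ sym)

  unmated-cols-uncharged : ∀ {S} → (∀ {c} → c ∈ S → ¬ RowMate S c) → ∀ j → Uncharged S (col j)
  unmated-cols-uncharged {S} ¬mates j c∈S eq = ¬mates c∈S (proj₂ (charged-to-col S eq))

  lines : List Line
  lines = map row (allFin n) ++ map col (allFin m)

  ∈-lines : ∀ ℓ → ℓ ∈ lines
  ∈-lines (row i) = ∈-++⁺ˡ (∈-map⁺ row (∈-allFin i))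
  ∈-lines (col j) = ∈-++⁺ʳ (map row (allFin n)) (∈-map⁺ col (∈-allFin j))

  length-lines : length lines ≡ n + m
  length-lines =
    trans (length-++ (map row (allFin n))) (cong₂ _+_ (length-map-allFin {k = n} row) (length-map-allFin {k = m} col))

  -- charge is injective on S and misses every line of U, and there are n + m lines.
  uncharged-count : ∀ {S U} → Unique S → CornerFree S → Unique U → All (Uncharged S) U →
                    length S + length U ≤ n + m
  uncharged-count {S} {U} uS cf uU unch = begin
    length S + length U                  ≡⟨ cong (_+ length U) (length-map (charge S) S) ⟨
    length (map (charge S) S) + length U ≡⟨ length-++ (map (charge S) S) ⟨
    length (map (charge S) S ++ U)       ≤⟨ unique-⊆⇒length-≤ charges++U-unique (λ {ℓ} _ → ∈-lines ℓ) ⟩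
    length lines                         ≡⟨ length-lines ⟩
    n + m                                ∎
    where
      open ≤-Reasoning
      charges++U-unique : Unique (map (charge S) S ++ U)
      charges++U-unique = Unique.++⁺ (map-injectiveOn-unique (charge S) (charge-injective cf) uS) uU
        λ (ℓ∈charges , ℓ∈U) → let _ , c∈S , ℓ≡ = ∈-map⁻ (charge S) ℓ∈charges in
                               All.lookup unch ℓ∈U c∈S (sym ℓ≡)

  three-uncharged-bound : ∀ {S ℓ₁ ℓ₂ ℓ₃} → Unique S → CornerFree S →
                          Uncharged S ℓ₁ → Uncharged S ℓ₂ → Uncharged S ℓ₃ →
                          ℓ₁ ≢ ℓ₂ → ℓ₁ ≢ ℓ₃ → ℓ₂ ≢ ℓ₃ → length S + 3 ≤ n + m
  three-uncharged-bound uS cf u₁ u₂ u₃ ℓ₁≢ℓ₂ ℓ₁≢ℓ₃ ℓ₂≢ℓ₃ =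
    uncharged-count uS cf ((ℓ₁≢ℓ₂ ∷ ℓ₁≢ℓ₃ ∷ []) ∷ (ℓ₂≢ℓ₃ ∷ []) ∷ [] ∷ []) (u₁ ∷ u₂ ∷ u₃ ∷ [])

  data RowWitness (S : List Cell) (k : Fin n) : Line → Set where
    the-row  : RowWitness S k (row k)
    a-column : ∀ {d} → (k , d) ∈ S → RowWitness S k (col d)

  record UnchargedWitness (S : List Cell) (k : Fin n) : Set where
    field
      {line}    : Line
      witness   : RowWitness S k line
      uncharged : Uncharged S line

  open UnchargedWitness public

  uncharged-row-witness : ∀ {S} → CornerFree S → ∀ k → UnchargedWitness S k
  uncharged-row-witness {S} cf k with uncharged-or-charged S (row k)
  ... | inj₁ row-k = record { witness = the-row ; uncharged = row-k }
  ... | inj₂ ((_ , d) , kd∈S , eq) with charged-to-row S eq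
  ...   | refl , ¬mate =
          record { witness = a-column kd∈S ; uncharged = unmated-col-uncharged cf kd∈S ¬mate }

  -- Witnesses of distinct rows can only coincide in a column meeting S in both rows.
  Apart : List Cell → Fin n → Fin n → Line → Set
  Apart S k k′ ℓ = ∀ {d} → ℓ ≡ col d → (k , d) ∈ S → (k′ , d) ∈ S → ⊥

  apart-witnesses-distinct : ∀ {S k k′ ℓ ℓ′} → k ≢ k′ → RowWitness S k ℓ → RowWitness S k′ ℓ′ →
                             Apart S k k′ ℓ → ℓ ≢ ℓ′
  apart-witnesses-distinct k≢k′ the-row      the-row      _     refl = k≢k′ refl
  apart-witnesses-distinct _    (a-column p) (a-column q) apart refl = apart refl p q

  three-witnesses-bound : ∀ {S k₁ k₂ k₃} → Unique S → CornerFree S → k₁ ≢ k₂ → k₁ ≢ k₃ → k₂ ≢ k₃ →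
                          (w₁ : UnchargedWitness S k₁) (w₂ : UnchargedWitness S k₂)
                          (w₃ : UnchargedWitness S k₃) →
                          Apart S k₁ k₂ (line w₁) → Apart S k₁ k₃ (line w₁) → Apart S k₂ k₃ (line w₂) →
                          length S + 3 ≤ n + m
  three-witnesses-bound uS cf k₁≢k₂ k₁≢k₃ k₂≢k₃ w₁ w₂ w₃ a₁₂ a₁₃ a₂₃ =
    three-uncharged-bound uS cf (uncharged w₁) (uncharged w₂) (uncharged w₃)
      (apart-witnesses-distinct k₁≢k₂ (witness w₁) (witness w₂) a₁₂)
      (apart-witnesses-distinct k₁≢k₃ (witness w₁) (witness w₃) a₁₃)
      (apart-witnesses-distinct k₂≢k₃ (witness w₂) (witness w₃) a₂₃)

  uncharged-col-witness : ∀ {S} d → Uncharged S (col d) ⊎ ∃ λ r → (r , d) ∈ S × Uncharged S (row r)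
  uncharged-col-witness {S} d with uncharged-or-charged S (col d)
  ... | inj₁ col-d = inj₁ col-d
  ... | inj₂ ((r , _) , rd∈S , eq) with charged-to-col S eq
  ...   | refl , mate = inj₂ (r , rd∈S , mated-row-uncharged rd∈S mate)

  -- A robot moves along its column from u = (i , j) to v = (i′ , j), turning S into S′. Witnesses of
  -- the rows i, i′ and a third row k give three uncharged lines, unless neither u nor v has a row-mate:
  -- then row i′ of S is empty, and row i′, column j and a witness of another column c are uncharged.
  module _ {S S′ i i′ j} (uS : Unique S) (cf : CornerFree S) (cf′ : CornerFree S′)
           (u∈S : (i , j) ∈ S) (v∉S : (i′ , j) ∉ S) (v∈S′ : (i′ , j) ∈ S′)
           (stays : ∀ {x} → x ∈ S → x ≢ (i , j) → x ∈ S′) (i≢i′ : i ≢ i′) where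

    private
      stays-off-row : ∀ {r d} → (r , d) ∈ S → r ≢ i → (r , d) ∈ S′
      stays-off-row rd∈S r≢i = stays rd∈S (r≢i ∘ cong proj₁)

      apart-i′ : ∀ {k ℓ} → k ≢ i → k ≢ i′ → Apart S i′ k ℓ
      apart-i′ k≢i k≢i′ _ i′d∈S kd∈S =
        cf′ (stays-off-row i′d∈S (i≢i′ ∘ sym)) v∈S′ (stays-off-row kd∈S k≢i)
            (λ { refl → v∉S i′d∈S }) k≢i′

      row-i′-empty : ¬ RowMate S′ (i′ , j) → ∀ {d} → (i′ , d) ∉ S
      row-i′-empty ¬v-mate {d} i′d∈S with d ≟ j
      ... | yes refl = v∉S i′d∈S
      ... | no  d≢j  = ¬v-mate (d , stays-off-row i′d∈S (i≢i′ ∘ sym) , d≢j)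

    column-move-bound : ∀ {k c} → k ≢ i → k ≢ i′ → c ≢ j → length S + 3 ≤ n + m
    column-move-bound {k} {c} k≢i k≢i′ c≢j with rowMate? S (i , j) | rowMate? S′ (i′ , j)
    ... | yes u-mate | _ =
      three-witnesses-bound uS cf i≢i′ (k≢i ∘ sym) (k≢i′ ∘ sym)
        (record { witness = the-row ; uncharged = mated-row-uncharged u∈S u-mate })
        (uncharged-row-witness cf i′) (uncharged-row-witness cf k) (λ ()) (λ ()) (apart-i′ k≢i k≢i′)
    ... | no ¬u-mate | yes (c′ , i′c′∈S′ , c′≢j) =
      three-witnesses-bound uS cf i≢i′ (k≢i ∘ sym) (k≢i′ ∘ sym)
        (record { witness = a-column u∈S ; uncharged = unmated-col-uncharged cf u∈S ¬u-mate })
        (uncharged-row-witness cf i′) (uncharged-row-witness cf k)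
        (λ { refl _ i′j∈S → v∉S i′j∈S })
        (λ { refl _ kj∈S → cf′ v∈S′ i′c′∈S′ (stays-off-row kj∈S k≢i) c′≢j k≢i′ })
        (apart-i′ k≢i k≢i′)
    ... | no ¬u-mate | no ¬v-mate with uncharged-col-witness {S} c
    ...   | inj₁ col-c =
            three-uncharged-bound uS cf (empty-row-uncharged (row-i′-empty ¬v-mate))
              (unmated-col-uncharged cf u∈S ¬u-mate) col-c
              (λ ()) (λ ()) (c≢j ∘ sym ∘ Sum.inj₂-injective)
    ...   | inj₂ (r , rc∈S , row-r) =
            three-uncharged-bound uS cf (empty-row-uncharged (row-i′-empty ¬v-mate))
              (unmated-col-uncharged cf u∈S ¬u-mate) row-r
              (λ ()) (λ { refl → row-i′-empty ¬v-mate rc∈S }) (λ ())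

-- Upper bounds

transpose : ∀ {n m} → List (Fin n × Fin m) → List (Fin m × Fin n)
transpose = map swap

module _ {n m : ℕ} {S : List (Fin n × Fin m)} where

  ∈-transpose⁻ : ∀ {i j} → (j , i) ∈ transpose S → (i , j) ∈ S
  ∈-transpose⁻ ji∈Sᵀ with ∈-map⁻ swap ji∈Sᵀ
  ... | _ , ij∈S , refl = ij∈S

  transpose-unique : Unique S → Unique (transpose S)
  transpose-unique = Unique.map⁺ (cong swap)

  transpose-cornerFree : Rook.CornerFree n m S → Rook.CornerFree m n (transpose S)
  transpose-cornerFree cf ij∈Sᵀ ij′∈Sᵀ i′j∈Sᵀ j′≢j i′≢i =
    cf (∈-transpose⁻ ij∈Sᵀ) (∈-transpose⁻ i′j∈Sᵀ) (∈-transpose⁻ ij′∈Sᵀ) i′≢i j′≢j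

another : ∀ {n} (i : Fin (2 + n)) → ∃ λ k → k ≢ i
another zero    = suc zero , λ ()
another (suc _) = zero , λ ()

another₂ : ∀ {n} (i i′ : Fin (3 + n)) → ∃ λ k → k ≢ i × k ≢ i′
another₂ zero          zero          = suc zero , (λ ()) , (λ ())
another₂ zero          (suc zero)    = suc (suc zero) , (λ ()) , (λ ())
another₂ zero          (suc (suc _)) = suc zero , (λ ()) , (λ ())
another₂ (suc zero)    zero          = suc (suc zero) , (λ ()) , (λ ())
another₂ (suc zero)    (suc _)       = zero , (λ ()) , (λ ())
another₂ (suc (suc _)) zero          = suc zero , (λ ()) , (λ ())
another₂ (suc (suc _)) (suc _)       = zero , (λ ()) , (λ ())

legalMove-bound : ∀ {a b S S′} → GenPos (K (3 + a) □ K (3 + b)) S →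
                  LegalMove (K (3 + a) □ K (3 + b)) S S′ → length S + 3 ≤ (3 + a) + (3 + b)
legalMove-bound {a} {b} gp ((i , j) , (i′ , _) , u∈S , v∉S , inj₁ (i≢i′ , refl) , gp′ , S′≈)
  with another₂ i i′ | another j
... | _ , k≢i , k≢i′ | _ , c≢j =
  column-move-bound (proj₁ gp) (GenPos⇒CornerFree gp) (GenPos⇒CornerFree gp′) u∈S v∉S
    (replacement-adds Board S′≈) (replacement-keeps Board S′≈) i≢i′ k≢i k≢i′ c≢j
  where
    open Rook (3 + a) (3 + b)
legalMove-bound {a} {b} {S} {S′} gp ((i , j) , (_ , j′) , u∈S , v∉S , inj₂ (refl , j≢j′) , gp′ , S′≈)
  with another₂ j j′ | another i
... | _ , k≢j , k≢j′ | _ , c≢i = begin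
  length S + 3             ≡⟨ cong (_+ 3) (length-map swap S) ⟨
  length (transpose S) + 3 ≤⟨ Rook.column-move-bound (3 + b) (3 + a) (transpose-unique (proj₁ gp))
                                (transpose-cornerFree (GenPos⇒CornerFree gp))
                                (transpose-cornerFree (GenPos⇒CornerFree gp′))
                                (∈-map⁺ swap u∈S) (v∉S ∘ ∈-transpose⁻)
                                (∈-map⁺ swap (replacement-adds Board S′≈)) staysᵀ j≢j′ k≢j k≢j′ c≢i ⟩
  (3 + b) + (3 + a)        ≡⟨ +-comm (3 + b) (3 + a) ⟩
  (3 + a) + (3 + b)        ∎
  where
    open ≤-Reasoning
    open Rook (3 + a) (3 + b) using (Board; GenPos⇒CornerFree)
    staysᵀ : ∀ {x} → x ∈ transpose S → x ≢ (j , i) → x ∈ transpose S′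
    staysᵀ x∈Sᵀ x≢u with ∈-map⁻ swap x∈Sᵀ
    ... | _ , y∈S , refl = ∈-map⁺ swap (replacement-keeps Board S′≈ y∈S (x≢u ∘ cong swap))

mobile-bound : ∀ {a b S} → Mobile (K (3 + a) □ K (3 + b)) S → length S + 3 ≤ (3 + a) + (3 + b)
mobile-bound {a} {b} {S} (gp , [] , done , visits) =
  ⊥-elim (GenPos⇒CornerFree gp (occupied (zero , zero)) (occupied (zero , suc zero))
                                (occupied (suc zero , zero)) (λ ()) (λ ()))
  where
    open Rook (3 + a) (3 + b)
    occupied : ∀ x → x ∈ S
    occupied x with visits x
    ... | here x∈S = x∈S
mobile-bound (gp , _ ∷ _ , move mv _ , _) = legalMove-bound gp mv

genPos-bound₁ : ∀ {n S} → GenPos (K n □ K 1) S → length S ≤ n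
genPos-bound₁ {n} {S} gp =
  +-cancelʳ-≤ 1 _ _
    (uncharged-count (proj₁ gp) (GenPos⇒CornerFree gp) ([] ∷ []) (unmated-cols-uncharged no-mate zero ∷ []))
  where
    open Rook n 1
    no-mate : ∀ {c} → c ∈ S → ¬ RowMate S c
    no-mate {_ , zero} _ (zero , _ , 0≢0) = 0≢0 refl

genPos-bound₂ : ∀ {a S} → GenPos (K (2 + a) □ K 2) S → length S ≤ 2 + a
genPos-bound₂ {a} {S} gp = +-cancelʳ-≤ 2 _ _ two-uncharged
  where
    open Rook (2 + a) 2
    uS : Unique S
    uS = proj₁ gp
    cf : CornerFree S
    cf = GenPos⇒CornerFree gp
    two-uncharged : length S + 2 ≤ (2 + a) + 2
    two-uncharged with any? (rowMate? S) S
    ... | yes some-mate with find some-mate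
    ...   | (i , _) , ij∈S , mate with another i
    ...     | k , k≢i = uncharged-count uS cf
                          ((apart-witnesses-distinct (k≢i ∘ sym) the-row (witness w) (λ ()) ∷ []) ∷ [] ∷ [])
                          (mated-row-uncharged ij∈S mate ∷ uncharged w ∷ [])
      where
        w : UnchargedWitness S k
        w = uncharged-row-witness cf k
    two-uncharged | no no-mates = uncharged-count uS cf (((λ ()) ∷ []) ∷ [] ∷ [])
      (unmated-cols-uncharged no-mate zero ∷ unmated-cols-uncharged no-mate (suc zero) ∷ [])
      where
        no-mate : ∀ {c} → c ∈ S → ¬ RowMate S c
        no-mate c∈S mate = no-mates (lose c∈S mate)

-- Mobile configurations

-- Configurations on K (1 + n′) □ K m: the robots of row zero stand in the columns Z,
-- and every other row suc r holds exactly one robot, in column g r.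
module Configurations (n′ m : ℕ) where

  open Rook (suc n′) m

  Conf : (Fin n′ → Fin m) → List (Fin m) → List Cell
  Conf g Z = map (zero ,_) Z ++ map (λ r → suc r , g r) (allFin n′)

  module _ {g : Fin n′ → Fin m} {Z : List (Fin m)} where

    ∈-Conf-zero⁺ : ∀ {c} → c ∈ Z → (zero , c) ∈ Conf g Z
    ∈-Conf-zero⁺ c∈Z = ∈-++⁺ˡ (∈-map⁺ (zero ,_) c∈Z)

    ∈-Conf-zero⁻ : ∀ {c} → (zero , c) ∈ Conf g Z → c ∈ Z
    ∈-Conf-zero⁻ p with ∈-++⁻ (map (zero ,_) Z) p
    ... | inj₁ q with ∈-map⁻ (zero ,_) q
    ...   | _ , c∈Z , refl = c∈Z
    ∈-Conf-zero⁻ p | inj₂ q with ∈-map⁻ (λ r → suc r , g r) q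
    ...   | _ , _ , ()

    ∈-Conf-suc⁺ : ∀ {r j} → j ≡ g r → (suc r , j) ∈ Conf g Z
    ∈-Conf-suc⁺ {r} refl = ∈-++⁺ʳ (map (zero ,_) Z) (∈-map⁺ (λ r → suc r , g r) (∈-allFin r))

    ∈-Conf-suc⁻ : ∀ {r j} → (suc r , j) ∈ Conf g Z → j ≡ g r
    ∈-Conf-suc⁻ p with ∈-++⁻ (map (zero ,_) Z) p
    ... | inj₁ q with ∈-map⁻ (zero ,_) q
    ...   | _ , _ , ()
    ∈-Conf-suc⁻ p | inj₂ q with ∈-map⁻ (λ r → suc r , g r) q
    ...   | _ , _ , refl = refl

  length-Conf : ∀ g Z → length (Conf g Z) ≡ length Z + n′
  length-Conf g Z = trans (length-++ (map (zero ,_) Z)) (cong₂ _+_ (length-map _ Z) (length-map-allFin _))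

  Conf-cong : ∀ {g g′} Z → (∀ r → g r ≡ g′ r) → Conf g Z ≡ Conf g′ Z
  Conf-cong Z g≗g′ = cong (map (zero ,_) Z ++_) (map-cong (λ r → cong (suc r ,_) (g≗g′ r)) (allFin n′))

  Conf-unique : ∀ {g Z} → Unique Z → Unique (Conf g Z)
  Conf-unique {g} {Z} uZ = Unique.++⁺ (Unique.map⁺ (cong proj₂) uZ)
    (Unique.map⁺ (Fin.suc-injective ∘ cong proj₁) (Unique.allFin⁺ n′)) λ (p , q) → zero≢suc p q
    where
      zero≢suc : ∀ {x} → x ∈ map (zero ,_) Z → x ∉ map (λ r → suc r , g r) (allFin n′)
      zero≢suc p q with ∈-map⁻ (zero ,_) p | ∈-map⁻ (λ r → suc r , g r) q
      ... | _ , _ , refl | _ , _ , ()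

  -- Only robots of row zero can have row-mates, so only they can be corners.
  Admissible : (Fin n′ → Fin m) → List (Fin m) → Set
  Admissible g Z = ∀ {c c′} → c ∈ Z → c′ ∈ Z → c′ ≢ c → ∀ r → g r ≢ c

  Conf-cornerFree : ∀ {g Z} → Admissible g Z → CornerFree (Conf g Z)
  Conf-cornerFree adm {zero} {zero}  _   _    _    _    i′≢i = i′≢i refl
  Conf-cornerFree adm {zero} {suc r} ij∈ ij′∈ i′j∈ j′≢j _    =
    adm (∈-Conf-zero⁻ ij∈) (∈-Conf-zero⁻ ij′∈) j′≢j r (sym (∈-Conf-suc⁻ i′j∈))
  Conf-cornerFree adm {suc r}        ij∈ ij′∈ _    j′≢j _    = j′≢j (trans (∈-Conf-suc⁻ ij′∈) (sym (∈-Conf-suc⁻ ij∈)))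

  Conf-genPos : ∀ {g Z} → Unique Z → Admissible g Z → GenPos Board (Conf g Z)
  Conf-genPos uZ adm = CornerFree⇒GenPos (Conf-unique uZ) (Conf-cornerFree adm)

  row-move : ∀ {g g′ Z} r → g′ r ≢ g r → (∀ s → s ≢ r → g s ≡ g′ s) → Unique Z → Admissible g′ Z →
             LegalMove Board (Conf g Z) (Conf g′ Z)
  row-move {g} {g′} {Z} r moved same uZ adm =
    (suc r , g r) , (suc r , g′ r) , ∈-Conf-suc⁺ refl , moved ∘ ∈-Conf-suc⁻ , inj₂ (refl , moved ∘ sym) ,
    Conf-genPos uZ adm ,
    replacement Board (≡-dec _≟_ _≟_) (moved ∘ sym ∘ ∈-Conf-suc⁻) (∈-Conf-suc⁺ refl)
      (keeps same) (keeps (λ s → sym ∘ same s))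
    where
      keeps : ∀ {h h′} → (∀ s → s ≢ r → h s ≡ h′ s) →
              ∀ {x} → x ∈ Conf h Z → x ≢ (suc r , h r) → x ∈ Conf h′ Z
      keeps _ {zero , _} x∈ _ = ∈-Conf-zero⁺ (∈-Conf-zero⁻ x∈)
      keeps same {suc s , _} x∈ x≢u with s ≟ r
      ... | yes refl = ⊥-elim (x≢u (cong (suc s ,_) (∈-Conf-suc⁻ x∈)))
      ... | no  s≢r  = ∈-Conf-suc⁺ (trans (∈-Conf-suc⁻ x∈) (same s s≢r))

  zero-move : ∀ {g Z Z′ c a} → c ∈ Z → a ∉ Z → c ∉ Z′ → a ∈ Z′ →
              (∀ {d} → d ∈ Z → d ≢ c → d ∈ Z′) → (∀ {d} → d ∈ Z′ → d ≢ a → d ∈ Z) →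
              Unique Z′ → Admissible g Z′ → LegalMove Board (Conf g Z) (Conf g Z′)
  zero-move {g} c∈Z a∉Z c∉Z′ a∈Z′ keeps came-from uZ′ adm =
    (zero , _) , (zero , _) , ∈-Conf-zero⁺ c∈Z , a∉Z ∘ ∈-Conf-zero⁻ , inj₂ (refl , λ { refl → a∉Z c∈Z }) ,
    Conf-genPos uZ′ adm ,
    replacement Board (≡-dec _≟_ _≟_) (c∉Z′ ∘ ∈-Conf-zero⁻) (∈-Conf-zero⁺ a∈Z′) (lift keeps) (lift came-from)
    where
      lift : ∀ {Y Y′ e} → (∀ {d} → d ∈ Y → d ≢ e → d ∈ Y′) →
             ∀ {x} → x ∈ Conf g Y → x ≢ (zero , e) → x ∈ Conf g Y′
      lift keeps {zero , _}  x∈ x≢ = ∈-Conf-zero⁺ (keeps (∈-Conf-zero⁻ x∈) (x≢ ∘ cong (zero ,_)))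
      lift _     {suc _ , _} x∈ _  = ∈-Conf-suc⁺ (∈-Conf-suc⁻ x∈)

  -- The column of row suc r once rows 1, …, k have moved from column a to column b.
  shifted : Fin m → Fin m → ℕ → Fin n′ → Fin m
  shifted a b k r with toℕ r <? k
  ... | yes _ = b
  ... | no  _ = a

  module _ {a b : Fin m} where

    shifted-below : ∀ {k r} → toℕ r < k → shifted a b k r ≡ b
    shifted-below {k} {r} r<k with toℕ r <? k
    ... | yes _  = refl
    ... | no r≮k = contradiction r<k r≮k

    shifted-above : ∀ {k r} → k ≤ toℕ r → shifted a b k r ≡ a
    shifted-above {k} {r} k≤r with toℕ r <? k
    ... | yes r<k = contradiction r<k (≤⇒≯ k≤r)
    ... | no  _   = refl

    shifted-off : ∀ {k r} → toℕ r ≢ k → shifted a b k r ≡ shifted a b (suc k) r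
    shifted-off {k} {r} r≢k with <-cmp (toℕ r) k
    ... | tri< r<k _ _ = trans (shifted-below r<k) (sym (shifted-below (m<n⇒m<1+n r<k)))
    ... | tri≈ _ r≡k _ = contradiction r≡k r≢k
    ... | tri> _ _ k<r = trans (shifted-above (<⇒≤ k<r)) (sym (shifted-above k<r))

    module _ {Z} (a≢b : a ≢ b) (uZ : Unique Z)
             (adm-a : Admissible (const a) Z) (adm-b : Admissible (const b) Z) where

      shifted-admissible : ∀ k → Admissible (shifted a b k) Z
      shifted-admissible k c∈Z c′∈Z c′≢c r with toℕ r <? k
      ... | yes _ = adm-b c∈Z c′∈Z c′≢c r
      ... | no  _ = adm-a c∈Z c′∈Z c′≢c r

      ladder-to : ∀ k → k ≤ n′ → ∃ λ Ss → Run Board (Conf (const a) Z) (Conf (shifted a b k) Z) Ss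
      ladder-to zero    _     = [] , []
      ladder-to (suc k) k<n′ with ladder-to k (<⇒≤ k<n′)
      ... | _ , run = _ , run ▷ (row-move R moved same uZ (shifted-admissible (suc k)) ∷ [])
        where
          R : Fin n′
          R = fromℕ< k<n′
          toℕ-R : toℕ R ≡ k
          toℕ-R = Fin.toℕ-fromℕ< k<n′
          moved : shifted a b (suc k) R ≢ shifted a b k R
          moved eq = a≢b (begin
            a                    ≡⟨ shifted-above (≤-reflexive (sym toℕ-R)) ⟨
            shifted a b k R       ≡⟨ eq ⟨
            shifted a b (suc k) R ≡⟨ shifted-below (s≤s (≤-reflexive toℕ-R)) ⟩
            b                    ∎)
            where open ≡-Reasoning
          same : ∀ s → s ≢ R → shifted a b k s ≡ shifted a b (suc k) s
          same s s≢R = shifted-off λ s≡k → s≢R (Fin.toℕ-injective (trans s≡k (sym toℕ-R)))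

      ladder : ∃ λ Ss → Run Board (Conf (const a) Z) (Conf (const b) Z) Ss
      ladder with ladder-to n′ ≤-refl
      ... | Ss , run = Ss , subst (λ T → Run Board _ T Ss) (Conf-cong Z λ r → shifted-below (Fin.toℕ<n r)) run

  singleton-admissible : ∀ {g c} → Admissible g (c ∷ [])
  singleton-admissible (here refl) (here refl) c≢c = ⊥-elim (c≢c refl)

  record AllBut (Z : List (Fin m)) (p q : Fin m) : Set where
    field
      unique : Unique Z
      ∈⁺     : ∀ {c} → c ≢ p → c ≢ q → c ∈ Z
      ∈⁻     : ∀ {c} → c ∈ Z → c ≢ p × c ≢ q

  module _ {Z : List (Fin m)} {p q : Fin m} (Z-allBut : AllBut Z p q) where
    open AllBut Z-allBut

    allBut-sym : AllBut Z q p
    allBut-sym = record { unique = unique ; ∈⁺ = λ c≢q c≢p → ∈⁺ c≢p c≢q ; ∈⁻ = Product.swap ∘ ∈⁻ }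

    allBut-admissible : ∀ {a} → a ≡ p ⊎ a ≡ q → Admissible (const a) Z
    allBut-admissible (inj₁ refl) c∈Z _ _ _ = proj₁ (∈⁻ c∈Z) ∘ sym
    allBut-admissible (inj₂ refl) c∈Z _ _ _ = proj₂ (∈⁻ c∈Z) ∘ sym

  allBut-ladder : ∀ {Z a b} → AllBut Z a b → a ≢ b →
                  ∃ λ Ss → Run Board (Conf (const a) Z) (Conf (const b) Z) Ss
  allBut-ladder Z-allBut a≢b = ladder a≢b (AllBut.unique Z-allBut)
    (allBut-admissible Z-allBut (inj₁ refl)) (allBut-admissible Z-allBut (inj₂ refl))

  others : Fin m → Fin m → List (Fin m)
  others p q = filter (λ c → ¬? (c ≟ p) ×-dec ¬? (c ≟ q)) (allFin m)

  allBut : ∀ p q → AllBut (others p q) p q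
  allBut p q = record
    { unique = Unique.filter⁺ avoids? (Unique.allFin⁺ m)
    ; ∈⁺     = λ c≢p c≢q → ∈-filter⁺ avoids? (∈-allFin _) (c≢p , c≢q)
    ; ∈⁻     = proj₂ ∘ ∈-filter⁻ avoids? {xs = allFin m}
    }
    where
      avoids? : ∀ c → Dec (c ≢ p × c ≢ q)
      avoids? c = ¬? (c ≟ p) ×-dec ¬? (c ≟ q)

  -- The robot of row zero in column c steps to column p; the other rows stay in column q.
  zero-swap : ∀ {Z Z′ p q c} → AllBut Z p q → AllBut Z′ c q → c ≢ p → c ≢ q → p ≢ q →
              LegalMove Board (Conf (const q) Z) (Conf (const q) Z′)
  zero-swap Z-allBut Z′-allBut c≢p c≢q p≢q =
    zero-move (Z.∈⁺ c≢p c≢q) (λ p∈Z → proj₁ (Z.∈⁻ p∈Z) refl)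
      (λ c∈Z′ → proj₁ (Z′.∈⁻ c∈Z′) refl) (Z′.∈⁺ (c≢p ∘ sym) p≢q)
      (λ d∈Z d≢c → Z′.∈⁺ d≢c (proj₂ (Z.∈⁻ d∈Z))) (λ d∈Z′ d≢p → Z.∈⁺ d≢p (proj₂ (Z′.∈⁻ d∈Z′)))
      Z′.unique (allBut-admissible Z′-allBut (inj₂ refl))
    where
      module Z  = AllBut Z-allBut
      module Z′ = AllBut Z′-allBut

module ManyColumns (n′ k : ℕ) where

  open Rook (suc n′) (3 + k)
  open Configurations n′ (3 + k)

  suc₂ : Fin (suc k) → Fin (3 + k)
  suc₂ t = suc (suc t)

  Z₀ : List (Fin (3 + k))
  Z₀ = map suc₂ (allFin (suc k))

  Z₀-allBut : AllBut Z₀ zero (suc zero)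
  Z₀-allBut = record
    { unique = Unique.map⁺ (Fin.suc-injective ∘ Fin.suc-injective) (Unique.allFin⁺ (suc k))
    ; ∈⁺     = ∈⁺
    ; ∈⁻     = ∈⁻
    }
    where
      ∈⁺ : ∀ {c} → c ≢ zero → c ≢ suc zero → c ∈ Z₀
      ∈⁺ {zero}        c≢0 _   = ⊥-elim (c≢0 refl)
      ∈⁺ {suc zero}    _   c≢1 = ⊥-elim (c≢1 refl)
      ∈⁺ {suc (suc t)} _   _   = ∈-map⁺ suc₂ (∈-allFin t)
      ∈⁻ : ∀ {c} → c ∈ Z₀ → c ≢ zero × c ≢ suc zero
      ∈⁻ c∈Z₀ with ∈-map⁻ suc₂ c∈Z₀
      ... | _ , _ , refl = (λ ()) , (λ ())

  start : List Cell
  start = Conf (const zero) Z₀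

  Covered : Fin (3 + k) → Cell → Set
  Covered x (i , j) = i ≡ zero ⊎ j ∈ zero ∷ suc zero ∷ x ∷ []

  -- The other rows go round the columns 0 → 1 → x → 0 while row zero keeps out of their way.
  round : ∀ t → Trip Board start start (Covered (suc (suc t)))
  round t = trip-weaken covered (L₁ ⨾ M₁ ⨾ L₂ ⨾ M₂ ⨾ L₃ ⨾ M₃)
    where
      x : Fin (3 + k)
      x = suc (suc t)
      A₁ : AllBut (others x (suc zero)) x (suc zero)
      A₁ = allBut x (suc zero)
      A₂ : AllBut (others x zero) x zero
      A₂ = allBut x zero
      C₁ C₂ C₃ C₄ C₅ : List Cell
      C₁ = Conf (const (suc zero)) Z₀
      C₂ = Conf (const (suc zero)) (others x (suc zero))
      C₃ = Conf (const x) (others x (suc zero))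
      C₄ = Conf (const x) (others x zero)
      C₅ = Conf (const zero) (others x zero)
      L₁ : Leg Board start C₁
      L₁ = run⇒trip (proj₂ (allBut-ladder Z₀-allBut λ ()))
      M₁ : Leg Board C₁ C₂
      M₁ = move⇒trip (zero-swap Z₀-allBut A₁ (λ ()) (λ ()) (λ ()))
      L₂ : Leg Board C₂ C₃
      L₂ = run⇒trip (proj₂ (allBut-ladder (allBut-sym A₁) λ ()))
      M₂ : Leg Board C₃ C₄
      M₂ = move⇒trip (zero-swap (allBut-sym A₁) (allBut-sym A₂) (λ ()) (λ ()) (λ ()))
      L₃ : Leg Board C₄ C₅
      L₃ = run⇒trip (proj₂ (allBut-ladder A₂ λ ()))
      M₃ : Leg Board C₅ start
      M₃ = move⇒trip (zero-swap A₂ (allBut-sym Z₀-allBut) (λ ()) (λ ()) (λ ()))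
      covered : Covered x ⊆′ (_∈ C₁) ∪ (_∈ C₂) ∪ (_∈ C₃) ∪ (_∈ C₄) ∪ (_∈ C₅) ∪ (_∈ start)
      covered {zero , zero}        _ = inj₂ (inj₁ (∈-Conf-zero⁺ (AllBut.∈⁺ A₁ (λ ()) (λ ()))))
      covered {zero , suc zero}    _ = inj₂ (inj₂ (inj₂ (inj₁ (∈-Conf-zero⁺ (AllBut.∈⁺ A₂ (λ ()) (λ ()))))))
      covered {zero , suc (suc _)} _ = inj₂ (inj₂ (inj₂ (inj₂ (inj₂ (∈-Conf-zero⁺ (AllBut.∈⁺ Z₀-allBut (λ ()) (λ ())))))))
      covered {suc _ , _} (inj₂ (here refl))                 = inj₂ (inj₂ (inj₂ (inj₂ (inj₂ (∈-Conf-suc⁺ refl)))))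
      covered {suc _ , _} (inj₂ (there (here refl)))         = inj₁ (∈-Conf-suc⁺ refl)
      covered {suc _ , _} (inj₂ (there (there (here refl)))) = inj₂ (inj₂ (inj₁ (∈-Conf-suc⁺ refl)))

  start-mobile : Mobile Board start
  start-mobile = trip⇒mobile (Conf-genPos (AllBut.unique Z₀-allBut) (allBut-admissible Z₀-allBut (inj₁ refl)))
                             (concat-loops (allFin (suc k)) round) covered
    where
      covered : ∀ y → Any (λ t → Covered (suc (suc t)) y) (allFin (suc k))
      covered (zero  , _)           = lose (∈-allFin zero) (inj₁ refl)
      covered (suc _ , zero)        = lose (∈-allFin zero) (inj₂ (here refl))
      covered (suc _ , suc zero)    = lose (∈-allFin zero) (inj₂ (there (here refl)))
      covered (suc _ , suc (suc t)) = lose (∈-allFin t) (inj₂ (there (there (here refl))))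

  length-start : length start ≡ suc k + n′
  length-start = trans (length-Conf _ Z₀) (cong (_+ n′) (length-map-allFin suc₂))

module OneColumn (n′ : ℕ) where

  open Rook (suc n′) 1
  open Configurations n′ 1

  start : List Cell
  start = Conf (const zero) (zero ∷ [])

  start-mobile : Mobile Board start
  start-mobile = trip⇒mobile (Conf-genPos ([] ∷ []) singleton-admissible) stay occupied
    where
      occupied : ∀ x → x ∈ start
      occupied (zero  , zero) = ∈-Conf-zero⁺ (here refl)
      occupied (suc _ , zero) = ∈-Conf-suc⁺ refl

module TwoColumns (n′ : ℕ) where

  open Rook (suc n′) 2
  open Configurations n′ 2

  start end : List Cell
  start = Conf (const zero) (zero ∷ [])
  end   = Conf (const (suc zero)) (suc zero ∷ [])

  start-mobile : Mobile Board start
  start-mobile =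
    trip⇒mobile (Conf-genPos ([] ∷ []) singleton-admissible)
                (stay ⨾ ladder₀₁ ⨾ swap₀₁) covered
    where
      C : List Cell
      C = Conf (const (suc zero)) (zero ∷ [])
      ladder₀₁ : Leg Board start C
      ladder₀₁ = run⇒trip (proj₂ (ladder (λ ()) ([] ∷ []) singleton-admissible singleton-admissible))
      swap₀₁ : Leg Board C end
      swap₀₁ = move⇒trip (zero-move (here refl) (λ { (here ()) ; (there ()) }) (λ { (here ()) ; (there ()) })
                 (here refl) (λ { (here refl) 0≢0 → ⊥-elim (0≢0 refl) ; (there ()) _ })
                 (λ { (here refl) 1≢1 → ⊥-elim (1≢1 refl) ; (there ()) _ }) ([] ∷ []) singleton-admissible)
      covered : ∀ x → ((_∈ start) ∪ (_∈ C) ∪ (_∈ end)) x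
      covered (zero  , zero)     = inj₁ (∈-Conf-zero⁺ (here refl))
      covered (suc _ , zero)     = inj₁ (∈-Conf-suc⁺ refl)
      covered (suc _ , suc zero) = inj₂ (inj₁ (∈-Conf-suc⁺ refl))
      covered (zero  , suc zero) = inj₂ (inj₂ (∈-Conf-zero⁺ (here refl)))

mob-K□K₁ : ∀ {n} → 1 ≤ n → IsMob (K n □ K 1) n
mob-K□K₁ {suc n′} (s≤s _) =
  (start , start-mobile , length-Conf (const zero) (zero ∷ [])) , λ _ → genPos-bound₁ ∘ proj₁
  where
    open OneColumn n′
    open Configurations n′ 1 using (length-Conf)

mob-K□K₂ : ∀ {n} → 2 ≤ n → IsMob (K n □ K 2) n
mob-K□K₂ {suc (suc a)} (s≤s (s≤s _)) =
  (start , start-mobile , length-Conf (const zero) (zero ∷ [])) , λ _ → genPos-bound₂ ∘ proj₁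
  where
    open TwoColumns (suc a)
    open Configurations (suc a) 2 using (length-Conf)

mob-K□K : ∀ {n m} → 3 ≤ n → 3 ≤ m → IsMob (K n □ K m) (n + m ∸ 3)
mob-K□K {suc (suc (suc a))} {suc (suc (suc b))} (s≤s (s≤s (s≤s _))) (s≤s (s≤s (s≤s _))) =
  (start , start-mobile , trans length-start (rearrange a b)) , λ S → m+n≤o⇒m≤o∸n (length S) ∘ mobile-bound
  where
    open ManyColumns (2 + a) b
    rearrange : ∀ a b → suc b + (2 + a) ≡ a + (3 + b)
    rearrange = solve-∀

theorem2p4 : ∀ (n m : ℕ) → 1 ≤ m → m ≤ n →
    (m ≤ 2 → IsMob (K n □ K m) n) × (3 ≤ m → IsMob (K n □ K m) (n + m ∸ 3))
theorem2p4 n 1                   _ 1≤n = (λ _ → mob-K□K₁ 1≤n) , λ { (s≤s ()) }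
theorem2p4 n 2                   _ 2≤n = (λ _ → mob-K□K₂ 2≤n) , λ { (s≤s (s≤s ())) }
theorem2p4 n (suc (suc (suc _))) _ m≤n = (λ { (s≤s (s≤s ())) }) , λ 3≤m → mob-K□K (≤-trans 3≤m m≤n) 3≤m
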